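{- Let $G$ be a finite simple connected graph with $m$ edges and edge set $E$. Then $$\Big\{\sum_{(i,j)\in E}|d_i-d_j|\Big\}^2 \le m\,(F(G)-2M_2(G)) = m\, d^T L d,$$ with equality if and only if $G$ is regular or weakly semiregular.
   Context: All graphs are finite, simple and connected with $n\ge 3$ vertices $v_1,\dots,v_n$; $d_i$ is the degree of $v_i$, $d=(d_1,\dots,d_n)^T$, and $(i,j)$ denotes the edge joining $v_i$ and $v_j$. $M_2(G)=\sum_{(i,j)\in E} d_id_j$, $F(G)=\sum_i d_i^3$, and $L=D-A$ is the Laplacian matrix ($A$ adjacency matrix, $D$ diagonal degree matrix). A graph is regular if all vertices have the same degree. A connected non-regular graph $G$ is weakly semiregular if there is a positive integer $\varepsilon$ such that $|d_i-d_j|=\varepsilon$ for every edge $(i,j)$ of $G$. -}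

module Defs where

open import Data.Nat as ℕ using (ℕ; zero; suc; ∣_-_∣)
open import Data.Integer as ℤ using (ℤ; +_; _+_; _*_; -_; _-_)
open import Data.Fin as Fin using (Fin; zero; suc)
open import Data.Bool using (Bool; true; false; if_then_else_; _∧_)
open import Data.Product using (Σ; _×_)
open import Relation.Binary.PropositionalEquality using (_≡_)
open import Relation.Nullary using (¬_)
open import Relation.Nullary.Decidable using (⌊_⌋)

record Graph (n : ℕ) : Set where
  field
    adj    : Fin n → Fin n → Bool
    adj-sym : ∀ i j → adj i j ≡ adj j i
    loopless : ∀ i → adj i i ≡ false
open Graph public

sumℕ : ∀ {n} → (Fin n → ℕ) → ℕ
sumℕ {zero}  f = 0
sumℕ {suc n} f = f zero ℕ.+ sumℕ (λ i → f (suc i))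

sumℤ : ∀ {n} → (Fin n → ℤ) → ℤ
sumℤ {zero}  f = + 0
sumℤ {suc n} f = f zero + sumℤ (λ i → f (suc i))

data Reach {n} (G : Graph n) : Fin n → Fin n → Set where
  here : ∀ {i} → Reach G i i
  step : ∀ {i k j} → adj G i k ≡ true → Reach G k j → Reach G i j

Connected : ∀ {n} → Graph n → Set
Connected G = ∀ i j → Reach G i j

deg : ∀ {n} → Graph n → Fin n → ℕ
deg G i = sumℕ (λ j → if adj G i j then 1 else 0)

dℤ : ∀ {n} → Graph n → Fin n → ℤ
dℤ G i = + deg G i

-- Σ over the edge set E: each edge (i,j) counted once (as the pair with i < j)
edgeSum : ∀ {n} → Graph n → (Fin n → Fin n → ℤ) → ℤ
edgeSum G f = sumℤ (λ i → sumℤ (λ j →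
  if ⌊ i Fin.<? j ⌋ ∧ adj G i j then f i j else + 0))

edges : ∀ {n} → Graph n → ℤ
edges G = edgeSum G (λ _ _ → + 1)

M₂ : ∀ {n} → Graph n → ℤ
M₂ G = edgeSum G (λ i j → dℤ G i * dℤ G j)

F : ∀ {n} → Graph n → ℤ
F G = sumℤ (λ i → dℤ G i * dℤ G i * dℤ G i)

Aℤ : ∀ {n} → Graph n → Fin n → Fin n → ℤ
Aℤ G i j = if adj G i j then + 1 else + 0

Dℤ : ∀ {n} → Graph n → Fin n → Fin n → ℤ
Dℤ G i j = if ⌊ i Fin.≟ j ⌋ then dℤ G i else + 0

Lap : ∀ {n} → Graph n → Fin n → Fin n → ℤ
Lap G i j = Dℤ G i j - Aℤ G i j

dᵀLd : ∀ {n} → Graph n → ℤ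
dᵀLd G = sumℤ (λ i → sumℤ (λ j → dℤ G i * Lap G i j * dℤ G j))

Regular : ∀ {n} → Graph n → Set
Regular G = ∀ i j → deg G i ≡ deg G j

WeaklySemiregular : ∀ {n} → Graph n → Set
WeaklySemiregular G =
  Connected G × ¬ Regular G ×
  Σ ℕ (λ ε → (0 ℕ.< ε) × (∀ i j → adj G i j ≡ true → ∣ deg G i - deg G j ∣ ≡ ε))

-- For an edge e = (i, j) put x_e = |d_i - d_j|. Counting every edge from both of its
-- endpoints gives Σ_e (d_i² + d_j²) = Σ_i d_i · d_i² = F(G), hence Σ_e x_e² = F - 2M₂;
-- the same count shows dᵀLd = F - 2M₂. The inequality is Cauchy–Schwarz for the m numbers
-- x_e in Lagrange's form  m Σ x_e² - (Σ x_e)² = Σ_{e before f} (x_e - x_f)²,  so equality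
-- holds iff all x_e equal one ε. If ε = 0, degrees are constant along walks, so G is
-- regular; if ε > 0, G is weakly semiregular by definition.
module Submission where

open import Defs
open import Data.Nat using (ℕ; _≤_; ∣_-_∣)
open import Data.Integer using (ℤ; +_; _*_; _-_) renaming (_≤_ to _≤ℤ_)
open import Data.Product using (_×_)
open import Data.Sum using (_⊎_)
open import Function.Bundles using (_⇔_)
open import Relation.Binary.PropositionalEquality using (_≡_)

open import Algebra.Properties.Semiring.Sum as Sum using ()
open import Data.Bool using (Bool; true; false; if_then_else_; _∧_)
open import Data.Bool.Properties using (T-∧; T-≡; if-float)
open import Data.Fin as Fin using (Fin; zero; suc; _<?_; _≟_)
open import Data.Fin.Properties using (<-cmp; <-irrefl)
open import Data.Integer using (_+_; -_; +≤+; -[1+_])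
import Data.Integer.Properties as ℤP
open import Data.Integer.Tactic.RingSolver using (solve-∀)
open import Data.List
  using (List; []; _∷_; _++_; map; length; tabulate; allFin; cartesianProduct; filterᵇ)
open import Data.List.Membership.Propositional using (_∈_)
open import Data.List.Membership.Propositional.Properties
  using (∈-filter⁺; ∈-filter⁻; ∈-cartesianProduct⁺; ∈-allFin)
open import Data.List.Relation.Unary.Any using (here; there)
import Data.Nat as ℕ
open import Data.Nat using (suc; z≤n; s≤s)
import Data.Nat.Properties as ℕP
open import Data.Product using (Σ; ∃₂; _,_; proj₁; proj₂; uncurry)
open import Data.Sum using (inj₁; inj₂)
open import Function using (_∘_; flip)
open import Function.Bundles using (mk⇔; Equivalence)
import Function.Properties.Equivalence as ⇔
open import Relation.Binary.Definitions using (tri<; tri≈; tri>)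
open import Relation.Binary.PropositionalEquality
  using (refl; sym; trans; cong; cong₂; subst₂; module ≡-Reasoning)
open import Relation.Nullary using (¬_; yes; no; contradiction)
open import Relation.Nullary.Decidable
  using (⌊_⌋; T?; dec-true; dec-false; isYes≗does; ⌊⌋-map′; fromWitness)

open Sum ℤP.+-*-semiring using (sum; sum-cong-≗; sum-replicate-zero; ∑-distrib-+; ∑-comm; *-distribˡ-sum)
open Equivalence using (to; from)
open ≡-Reasoning

0≤i*i : ∀ i → + 0 ≤ℤ i * i
0≤i*i (+ m)    rewrite ℤP.+◃n≡+n (m ℕ.* m) = +≤+ z≤n
0≤i*i -[1+ m ] = +≤+ z≤n

i*i≡0⇒i≡0 : ∀ i → i * i ≡ + 0 → i ≡ + 0
i*i≡0⇒i≡0 i eq with ℤP.i*j≡0⇒i≡0∨j≡0 i eq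
... | inj₁ i≡0 = i≡0
... | inj₂ i≡0 = i≡0

nonneg-+≡0 : ∀ {i j} → + 0 ≤ℤ i → + 0 ≤ℤ j → i + j ≡ + 0 → i ≡ + 0 × j ≡ + 0
nonneg-+≡0 {+ m} {+ n} _ _ eq =
  cong +_ (ℕP.m+n≡0⇒m≡0 m m+n≡0) , cong +_ (ℕP.m+n≡0⇒n≡0 m m+n≡0)
  where
  m+n≡0 : m ℕ.+ n ≡ 0
  m+n≡0 = ℤP.+-injective (trans (sym (ℤP.pos-+ m n)) eq)

∣m-n∣²≡[m-n]² : ∀ m n → + ∣ m - n ∣ * + ∣ m - n ∣ ≡ (+ m - + n) * (+ m - + n)
∣m-n∣²≡[m-n]² 0       n       = square-neg (+ n)
  where
  square-neg : ∀ x → x * x ≡ (+ 0 - x) * (+ 0 - x)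
  square-neg = solve-∀
∣m-n∣²≡[m-n]² (suc m) 0       = square-sub0 (+ suc m)
  where
  square-sub0 : ∀ x → x * x ≡ (x - + 0) * (x - + 0)
  square-sub0 = solve-∀
∣m-n∣²≡[m-n]² (suc m) (suc n) = trans (∣m-n∣²≡[m-n]² m n) (cong (λ t → t * t) (sym suc-diff))
  where
  suc-diff : + suc m - + suc n ≡ + m - + n
  suc-diff = trans (ℤP.[1+m]⊖[1+n]≡m⊖n m n) (sym (ℤP.m-n≡m⊖n m n))

sumBy : {A : Set} → (A → ℤ) → List A → ℤ
sumBy f []       = + 0
sumBy f (x ∷ xs) = f x + sumBy f xs

module _ {A : Set} where

  sumBy-cong : ∀ {f g : A → ℤ} → (∀ x → f x ≡ g x) → ∀ xs → sumBy f xs ≡ sumBy g xs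
  sumBy-cong f≗g []       = refl
  sumBy-cong f≗g (x ∷ xs) = cong₂ _+_ (f≗g x) (sumBy-cong f≗g xs)

  sumBy-+ : ∀ (f g : A → ℤ) xs → sumBy (λ x → f x + g x) xs ≡ sumBy f xs + sumBy g xs
  sumBy-+ f g []       = refl
  sumBy-+ f g (x ∷ xs) = trans (cong (λ s → (f x + g x) + s) (sumBy-+ f g xs)) (interchange (f x) (g x) _ _)
    where
    interchange : ∀ a b c d → (a + b) + (c + d) ≡ (a + c) + (b + d)
    interchange = solve-∀

  sumBy-* : ∀ k (f : A → ℤ) xs → sumBy (λ x → k * f x) xs ≡ k * sumBy f xs
  sumBy-* k f []       = sym (ℤP.*-zeroʳ k)
  sumBy-* k f (x ∷ xs) = trans (cong (λ s → k * f x + s) (sumBy-* k f xs)) (sym (ℤP.*-distribˡ-+ k (f x) _))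

  sumBy-linear : ∀ k (f g : A → ℤ) xs → sumBy (λ x → f x + k * g x) xs ≡ sumBy f xs + k * sumBy g xs
  sumBy-linear k f g xs =
    trans (sumBy-+ f (λ x → k * g x) xs) (cong (λ s → sumBy f xs + s) (sumBy-* k g xs))

  sumBy-++ : ∀ (f : A → ℤ) xs ys → sumBy f (xs ++ ys) ≡ sumBy f xs + sumBy f ys
  sumBy-++ f []       ys = sym (ℤP.+-identityˡ _)
  sumBy-++ f (x ∷ xs) ys = trans (cong (λ s → f x + s) (sumBy-++ f xs ys)) (sym (ℤP.+-assoc (f x) _ _))

  sumBy-map : ∀ {B : Set} (f : B → ℤ) (g : A → B) xs → sumBy f (map g xs) ≡ sumBy (f ∘ g) xs
  sumBy-map f g []       = refl
  sumBy-map f g (x ∷ xs) = cong (λ s → f (g x) + s) (sumBy-map f g xs)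

  sumBy-filterᵇ : ∀ (f : A → ℤ) (c : A → Bool) xs →
                  sumBy f (filterᵇ c xs) ≡ sumBy (λ x → if c x then f x else + 0) xs
  sumBy-filterᵇ f c []       = refl
  sumBy-filterᵇ f c (x ∷ xs) with c x
  ... | true  = cong (λ s → f x + s) (sumBy-filterᵇ f c xs)
  ... | false = trans (sumBy-filterᵇ f c xs) (sym (ℤP.+-identityˡ _))

  sumBy-const-1 : ∀ xs → sumBy (λ (_ : A) → + 1) xs ≡ + length xs
  sumBy-const-1 []       = refl
  sumBy-const-1 (x ∷ xs) = cong (λ s → + 1 + s) (sumBy-const-1 xs)

  sumBy-nonneg : ∀ {f : A → ℤ} → (∀ x → + 0 ≤ℤ f x) → ∀ xs → + 0 ≤ℤ sumBy f xs
  sumBy-nonneg f≥0 []       = +≤+ z≤n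
  sumBy-nonneg f≥0 (x ∷ xs) = ℤP.+-mono-≤ (f≥0 x) (sumBy-nonneg f≥0 xs)

  sumBy-nonneg-≡0 : ∀ {f : A → ℤ} → (∀ x → + 0 ≤ℤ f x) →
                    ∀ xs → sumBy f xs ≡ + 0 → ∀ {x} → x ∈ xs → f x ≡ + 0
  sumBy-nonneg-≡0 f≥0 (y ∷ ys) eq (here refl) =
    proj₁ (nonneg-+≡0 (f≥0 y) (sumBy-nonneg f≥0 ys) eq)
  sumBy-nonneg-≡0 f≥0 (y ∷ ys) eq (there x∈ys) =
    sumBy-nonneg-≡0 f≥0 ys (proj₂ (nonneg-+≡0 (f≥0 y) (sumBy-nonneg f≥0 ys) eq)) x∈ys

  sumBy-≡0 : ∀ {f : A → ℤ} xs → (∀ {x} → x ∈ xs → f x ≡ + 0) → sumBy f xs ≡ + 0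
  sumBy-≡0 []       f≡0 = refl
  sumBy-≡0 (x ∷ xs) f≡0 = cong₂ _+_ (f≡0 (here refl)) (sumBy-≡0 xs (f≡0 ∘ there))

  sumBy-tabulate : ∀ {n} (f : A → ℤ) (g : Fin n → A) → sumBy f (tabulate g) ≡ sum (f ∘ g)
  sumBy-tabulate {ℕ.zero} f g = refl
  sumBy-tabulate {suc n}  f g = cong (λ s → f (g zero) + s) (sumBy-tabulate f (g ∘ suc))

sumBy-cartesianProduct : ∀ {A B : Set} (g : A → B → ℤ) xs ys →
  sumBy (uncurry g) (cartesianProduct xs ys) ≡ sumBy (λ a → sumBy (g a) ys) xs
sumBy-cartesianProduct g []       ys = refl
sumBy-cartesianProduct g (a ∷ xs) ys = begin
  sumBy (uncurry g) (map (a ,_) ys ++ cartesianProduct xs ys)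
    ≡⟨ sumBy-++ (uncurry g) (map (a ,_) ys) _ ⟩
  sumBy (uncurry g) (map (a ,_) ys) + sumBy (uncurry g) (cartesianProduct xs ys)
    ≡⟨ cong₂ _+_ (sumBy-map (uncurry g) (a ,_) ys) (sumBy-cartesianProduct g xs ys) ⟩
  sumBy (g a) ys + sumBy (λ a → sumBy (g a) ys) xs
    ∎

-- Cauchy–Schwarz with its equality case

module CauchySchwarz {A : Set} (x : A → ℤ) where

  ConstantOn : List A → Set
  ConstantOn ps = ∀ {p q} → p ∈ ps → q ∈ ps → x p ≡ x q

  spread : List A → ℤ
  spread []       = + 0
  spread (p ∷ ps) = spread ps + sumBy (λ q → (x p - x q) * (x p - x q)) ps

  sumBy-sq-diff : ∀ y ps → sumBy (λ q → (y - x q) * (y - x q)) ps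
                         ≡ y * y * + length ps - + 2 * y * sumBy x ps + sumBy (λ q → x q * x q) ps
  sumBy-sq-diff y []       = expand-nil y
    where
    expand-nil : ∀ y → + 0 ≡ y * y * + 0 - + 2 * y * + 0 + + 0
    expand-nil = solve-∀
  sumBy-sq-diff y (q ∷ ps) =
    trans (cong (λ s → (y - x q) * (y - x q) + s) (sumBy-sq-diff y ps))
          (expand-cons y (x q) (+ length ps) (sumBy x ps) (sumBy (λ q → x q * x q) ps))
    where
    expand-cons : ∀ y z w s u → (y - z) * (y - z) + (y * y * w - + 2 * y * s + u)
                              ≡ y * y * (+ 1 + w) - + 2 * y * (z + s) + (z * z + u)
    expand-cons = solve-∀

  lagrange : ∀ ps → + length ps * sumBy (λ q → x q * x q) ps - sumBy x ps * sumBy x ps ≡ spread ps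
  lagrange []       = refl
  lagrange (p ∷ ps) = begin
    (+ 1 + w) * (x p * x p + u) - (x p + s) * (x p + s)
      ≡⟨ split (x p) w s u ⟩
    (w * u - s * s) + (x p * x p * w - + 2 * x p * s + u)
      ≡⟨ cong₂ _+_ (lagrange ps) (sym (sumBy-sq-diff (x p) ps)) ⟩
    spread (p ∷ ps)
      ∎
    where
    w s u : ℤ
    w = + length ps
    s = sumBy x ps
    u = sumBy (λ q → x q * x q) ps
    split : ∀ y w s u → (+ 1 + w) * (y * y + u) - (y + s) * (y + s)
                      ≡ (w * u - s * s) + (y * y * w - + 2 * y * s + u)
    split = solve-∀

  spread-nonneg : ∀ ps → + 0 ≤ℤ spread ps
  spread-nonneg []       = +≤+ z≤n
  spread-nonneg (p ∷ ps) =
    ℤP.+-mono-≤ (spread-nonneg ps) (sumBy-nonneg (λ q → 0≤i*i (x p - x q)) ps)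

  spread≡0⇒constantOn : ∀ ps → spread ps ≡ + 0 → ConstantOn ps
  spread≡0⇒constantOn (p ∷ ps) eq = constant
    where
    parts : spread ps ≡ + 0 × sumBy (λ q → (x p - x q) * (x p - x q)) ps ≡ + 0
    parts = nonneg-+≡0 (spread-nonneg ps) (sumBy-nonneg (λ q → 0≤i*i (x p - x q)) ps) eq
    head-equal : ∀ {q} → q ∈ ps → x p ≡ x q
    head-equal q∈ps = ℤP.i-j≡0⇒i≡j (x p) _
      (i*i≡0⇒i≡0 _ (sumBy-nonneg-≡0 (λ q → 0≤i*i (x p - x q)) ps (proj₂ parts) q∈ps))
    constant : ConstantOn (p ∷ ps)
    constant (here refl)  (here refl)  = refl
    constant (here refl)  (there q∈ps) = head-equal q∈ps
    constant (there p∈ps) (here refl)  = sym (head-equal p∈ps)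
    constant (there p∈ps) (there q∈ps) = spread≡0⇒constantOn ps (proj₁ parts) p∈ps q∈ps

  constantOn⇒spread≡0 : ∀ ps → ConstantOn ps → spread ps ≡ + 0
  constantOn⇒spread≡0 []       _        = refl
  constantOn⇒spread≡0 (p ∷ ps) constant = cong₂ _+_
    (constantOn⇒spread≡0 ps (λ p∈ q∈ → constant (there p∈) (there q∈)))
    (sumBy-≡0 ps (λ q∈ → cong (λ t → t * t) (ℤP.i≡j⇒i-j≡0 (constant (here refl) (there q∈)))))

  cauchySchwarz : ∀ ps → sumBy x ps * sumBy x ps ≤ℤ + length ps * sumBy (λ q → x q * x q) ps
  cauchySchwarz ps = ℤP.0≤i-j⇒j≤i (ℤP.≤-trans (spread-nonneg ps) (ℤP.≤-reflexive (sym (lagrange ps))))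

  cauchySchwarz-≡⇔constantOn : ∀ ps →
    (sumBy x ps * sumBy x ps ≡ + length ps * sumBy (λ q → x q * x q) ps) ⇔ ConstantOn ps
  cauchySchwarz-≡⇔constantOn ps = mk⇔ equal⇒constant constant⇒equal
    where
    equal⇒constant : sumBy x ps * sumBy x ps ≡ + length ps * sumBy (λ q → x q * x q) ps → ConstantOn ps
    equal⇒constant eq = spread≡0⇒constantOn ps (trans (sym (lagrange ps)) (ℤP.i≡j⇒i-j≡0 (sym eq)))
    constant⇒equal : ConstantOn ps → sumBy x ps * sumBy x ps ≡ + length ps * sumBy (λ q → x q * x q) ps
    constant⇒equal constant = sym (ℤP.i-j≡0⇒i≡j _ _ (trans (lagrange ps) (constantOn⇒spread≡0 ps constant)))

sumℤ≡sum : ∀ {n} (f : Fin n → ℤ) → sumℤ f ≡ sum f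
sumℤ≡sum {ℕ.zero} f = refl
sumℤ≡sum {suc n}  f = cong (λ s → f zero + s) (sumℤ≡sum (f ∘ suc))

sumℤ²≡sum² : ∀ {m n} (g : Fin m → Fin n → ℤ) → sumℤ (λ i → sumℤ (g i)) ≡ sum (λ i → sum (g i))
sumℤ²≡sum² g = trans (sumℤ≡sum (λ i → sumℤ (g i))) (sum-cong-≗ (λ i → sumℤ≡sum (g i)))

+-sumℕ : ∀ {n} (f : Fin n → ℕ) → + sumℕ f ≡ sum (λ i → + f i)
+-sumℕ {ℕ.zero} f = refl
+-sumℕ {suc n}  f = trans (ℤP.pos-+ (f zero) _) (cong (λ s → + f zero + s) (+-sumℕ (f ∘ suc)))

sum-linear : ∀ {n} k (f g : Fin n → ℤ) → sum (λ i → f i + k * g i) ≡ sum f + k * sum g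
sum-linear k f g =
  trans (∑-distrib-+ f (λ i → k * g i)) (cong (λ s → sum f + s) (sym (*-distribˡ-sum k g)))

sum²-linear : ∀ {m n} k (f g : Fin m → Fin n → ℤ) →
  sum (λ i → sum (λ j → f i j + k * g i j)) ≡ sum (λ i → sum (f i)) + k * sum (λ i → sum (g i))
sum²-linear k f g =
  trans (sum-cong-≗ (λ i → sum-linear k (f i) (g i))) (sum-linear k (λ i → sum (f i)) (λ i → sum (g i)))

sum-diagonal : ∀ {n} (i : Fin n) c → sum (λ j → if ⌊ i ≟ j ⌋ then c else + 0) ≡ c
sum-diagonal {suc n} zero    c = trans (cong (λ s → c + s) (sum-replicate-zero n)) (ℤP.+-identityʳ c)
sum-diagonal {suc n} (suc i) c = begin
  + 0 + sum (λ j → if ⌊ suc i ≟ suc j ⌋ then c else + 0)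
    ≡⟨ ℤP.+-identityˡ _ ⟩
  sum (λ j → if ⌊ suc i ≟ suc j ⌋ then c else + 0)
    ≡⟨ sum-cong-≗ (λ j → cong (λ b → if b then c else + 0) (⌊⌋-map′ _ _ (i ≟ j))) ⟩
  sum (λ j → if ⌊ i ≟ j ⌋ then c else + 0)
    ≡⟨ sum-diagonal i c ⟩
  c ∎

allPairs : ∀ n → List (Fin n × Fin n)
allPairs n = cartesianProduct (allFin n) (allFin n)

sum²≡sumBy-allPairs : ∀ {n} (g : Fin n → Fin n → ℤ) →
  sum (λ i → sum (g i)) ≡ sumBy (uncurry g) (allPairs n)
sum²≡sumBy-allPairs {n} g = begin
  sum (λ i → sum (g i))
    ≡⟨ sum-cong-≗ (λ i → sym (sumBy-tabulate (g i) (λ j → j))) ⟩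
  sum (λ i → sumBy (g i) (allFin n))
    ≡⟨ sym (sumBy-tabulate (λ i → sumBy (g i) (allFin n)) (λ i → i)) ⟩
  sumBy (λ i → sumBy (g i) (allFin n)) (allFin n)
    ≡⟨ sym (sumBy-cartesianProduct g (allFin n) (allFin n)) ⟩
  sumBy (uncurry g) (allPairs n)
    ∎

*-indicator : ∀ v b → v * (if b then + 1 else + 0) ≡ (if b then v else + 0)
*-indicator v true  = ℤP.*-identityʳ v
*-indicator v false = ℤP.*-zeroʳ v

-- Edge sums of a graph

module _ {n : ℕ} (G : Graph n) where

  private
    d : Fin n → ℤ
    d = dℤ G

  isOrientedEdge : Fin n × Fin n → Bool
  isOrientedEdge (i , j) = ⌊ i <? j ⌋ ∧ adj G i j

  edgeList : List (Fin n × Fin n)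
  edgeList = filterᵇ isOrientedEdge (allPairs n)

  edgeSum≡sumBy : ∀ f → edgeSum G f ≡ sumBy (uncurry f) edgeList
  edgeSum≡sumBy f = begin
    edgeSum G f
      ≡⟨ sumℤ²≡sum² (λ i j → if isOrientedEdge (i , j) then f i j else + 0) ⟩
    sum (λ i → sum (λ j → if isOrientedEdge (i , j) then f i j else + 0))
      ≡⟨ sum²≡sumBy-allPairs (λ i j → if isOrientedEdge (i , j) then f i j else + 0) ⟩
    sumBy (λ p → if isOrientedEdge p then uncurry f p else + 0) (allPairs n)
      ≡⟨ sym (sumBy-filterᵇ (uncurry f) isOrientedEdge (allPairs n)) ⟩
    sumBy (uncurry f) edgeList
      ∎

  edgeSum-cong : ∀ {f g} → (∀ i j → f i j ≡ g i j) → edgeSum G f ≡ edgeSum G g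
  edgeSum-cong {f} {g} f≗g = begin
    edgeSum G f                ≡⟨ edgeSum≡sumBy f ⟩
    sumBy (uncurry f) edgeList ≡⟨ sumBy-cong (λ (i , j) → f≗g i j) edgeList ⟩
    sumBy (uncurry g) edgeList ≡⟨ sym (edgeSum≡sumBy g) ⟩
    edgeSum G g                ∎

  edges≡length : edges G ≡ + length edgeList
  edges≡length = trans (edgeSum≡sumBy (λ _ _ → + 1)) (sumBy-const-1 edgeList)

  adj-split : ∀ i j v → (if adj G i j then v else + 0)
            ≡ (if isOrientedEdge (i , j) then v else + 0) + (if isOrientedEdge (j , i) then v else + 0)
  adj-split i j v rewrite adj-sym G j i with <-cmp i j
  ... | tri< i<j _ j≮i rewrite isYes≗does (i <? j) | isYes≗does (j <? i)
                             | dec-true (i <? j) i<j | dec-false (j <? i) j≮i = sym (ℤP.+-identityʳ _)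
  ... | tri≈ _ refl _  rewrite isYes≗does (i <? i) | dec-false (i <? i) (<-irrefl refl) | loopless G i = refl
  ... | tri> i≮j _ j<i rewrite isYes≗does (i <? j) | isYes≗does (j <? i)
                             | dec-false (i <? j) i≮j | dec-true (j <? i) j<i = sym (ℤP.+-identityˡ _)

  -- Every edge is met once from each of its endpoints.
  sum-adjacent : ∀ g → sum (λ i → sum (λ j → if adj G i j then g i j else + 0))
                     ≡ edgeSum G g + edgeSum G (flip g)
  sum-adjacent g = begin
    sum (λ i → sum (λ j → if adj G i j then g i j else + 0))
      ≡⟨ sum-cong-≗ (λ i → trans (sum-cong-≗ (λ j → adj-split i j (g i j))) (∑-distrib-+ (forward i) _)) ⟩
    sum (λ i → sum (forward i) + sum (λ j → backward j i))
      ≡⟨ ∑-distrib-+ (λ i → sum (forward i)) _ ⟩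
    sum (λ i → sum (forward i)) + sum (λ i → sum (λ j → backward j i))
      ≡⟨ cong (λ s → sum (λ i → sum (forward i)) + s) (∑-comm (λ i j → backward j i)) ⟩
    sum (λ i → sum (forward i)) + sum (λ j → sum (backward j))
      ≡⟨ sym (cong₂ _+_ (sumℤ²≡sum² forward) (sumℤ²≡sum² backward)) ⟩
    edgeSum G g + edgeSum G (flip g)
      ∎
    where
    forward backward : Fin n → Fin n → ℤ
    forward  i j = if isOrientedEdge (i , j) then g i j else + 0
    backward i j = if isOrientedEdge (i , j) then g j i else + 0

  dℤ≡sum-Aℤ : ∀ i → d i ≡ sum (Aℤ G i)
  dℤ≡sum-Aℤ i =
    trans (+-sumℕ (λ j → if adj G i j then 1 else 0)) (sum-cong-≗ (λ j → if-float +_ (adj G i j)))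

  F≡edgeSum : F G ≡ edgeSum G (λ i j → d i * d i) + edgeSum G (λ i j → d j * d j)
  F≡edgeSum = begin
    F G
      ≡⟨ sumℤ≡sum (λ i → d i * d i * d i) ⟩
    sum (λ i → d i * d i * d i)
      ≡⟨ sum-cong-≗ (λ i → cong (λ s → d i * d i * s) (dℤ≡sum-Aℤ i)) ⟩
    sum (λ i → d i * d i * sum (Aℤ G i))
      ≡⟨ sum-cong-≗ (λ i → *-distribˡ-sum (d i * d i) (Aℤ G i)) ⟩
    sum (λ i → sum (λ j → d i * d i * Aℤ G i j))
      ≡⟨ sum-cong-≗ (λ i → sum-cong-≗ (λ j → *-indicator (d i * d i) (adj G i j))) ⟩
    sum (λ i → sum (λ j → if adj G i j then d i * d i else + 0))
      ≡⟨ sum-adjacent (λ i j → d i * d i) ⟩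
    edgeSum G (λ i j → d i * d i) + edgeSum G (λ i j → d j * d j)
      ∎

  degreeGap : Fin n → Fin n → ℤ
  degreeGap i j = + ∣ deg G i - deg G j ∣

  F-2M₂≡edgeSum-degreeGap² : F G - + 2 * M₂ G ≡ edgeSum G (λ i j → degreeGap i j * degreeGap i j)
  F-2M₂≡edgeSum-degreeGap² = sym (begin
    edgeSum G (λ i j → degreeGap i j * degreeGap i j)
      ≡⟨ edgeSum≡sumBy _ ⟩
    sumBy (λ (i , j) → degreeGap i j * degreeGap i j) edgeList
      ≡⟨ sumBy-cong (λ (i , j) → gap²-expansion i j) edgeList ⟩
    sumBy (λ p → squares p + - (+ 2) * product p) edgeList
      ≡⟨ sumBy-linear (- (+ 2)) squares product edgeList ⟩
    sumBy squares edgeList + - (+ 2) * sumBy product edgeList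
      ≡⟨ cong₂ (λ a b → a + - (+ 2) * b) sum-squares (sym (edgeSum≡sumBy _)) ⟩
    F G + - (+ 2) * M₂ G
      ≡⟨ plus-as-minus (F G) (M₂ G) ⟩
    F G - + 2 * M₂ G
      ∎)
    where
    squares product : Fin n × Fin n → ℤ
    squares (i , j) = d i * d i + d j * d j
    product (i , j) = d i * d j
    sum-squares : sumBy squares edgeList ≡ F G
    sum-squares = begin
      sumBy squares edgeList
        ≡⟨ sumBy-+ (λ (i , j) → d i * d i) (λ (i , j) → d j * d j) edgeList ⟩
      sumBy (λ (i , j) → d i * d i) edgeList + sumBy (λ (i , j) → d j * d j) edgeList
        ≡⟨ sym (cong₂ _+_ (edgeSum≡sumBy _) (edgeSum≡sumBy _)) ⟩
      edgeSum G (λ i j → d i * d i) + edgeSum G (λ i j → d j * d j)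
        ≡⟨ sym F≡edgeSum ⟩
      F G
        ∎
    plus-as-minus : ∀ a b → a + - (+ 2) * b ≡ a - + 2 * b
    plus-as-minus = solve-∀
    gap²-expansion : ∀ i j → degreeGap i j * degreeGap i j ≡ squares (i , j) + - (+ 2) * product (i , j)
    gap²-expansion i j = trans (∣m-n∣²≡[m-n]² (deg G i) (deg G j)) (square-of-difference (d i) (d j))
      where
      square-of-difference : ∀ a b → (a - b) * (a - b) ≡ (a * a + b * b) + - (+ 2) * (a * b)
      square-of-difference = solve-∀

  dᵀLd≡F-2M₂ : dᵀLd G ≡ F G - + 2 * M₂ G
  dᵀLd≡F-2M₂ = begin
    dᵀLd G
      ≡⟨ sumℤ²≡sum² (λ i j → d i * Lap G i j * d j) ⟩
    sum (λ i → sum (λ j → d i * Lap G i j * d j))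
      ≡⟨ sum-cong-≗ (λ i → sum-cong-≗ (λ j → split (d i) (Dℤ G i j) (Aℤ G i j) (d j))) ⟩
    sum (λ i → sum (λ j → diagonal i j + - (+ 1) * adjacency i j))
      ≡⟨ sum²-linear (- (+ 1)) diagonal adjacency ⟩
    sum (λ i → sum (diagonal i)) + - (+ 1) * sum (λ i → sum (adjacency i))
      ≡⟨ cong₂ (λ a b → a + - (+ 1) * b) diagonal-part adjacency-part ⟩
    F G + - (+ 1) * (M₂ G + M₂ G)
      ≡⟨ rearrange (F G) (M₂ G) ⟩
    F G - + 2 * M₂ G
      ∎
    where
    diagonal adjacency : Fin n → Fin n → ℤ
    diagonal  i j = d i * Dℤ G i j * d j
    adjacency i j = d i * Aℤ G i j * d j
    split : ∀ a b c e → a * (b - c) * e ≡ a * b * e + - (+ 1) * (a * c * e)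
    split = solve-∀
    rearrange : ∀ f m → f + - (+ 1) * (m + m) ≡ f - + 2 * m
    rearrange = solve-∀
    vanishes : ∀ a b → a * + 0 * b ≡ + 0
    vanishes = solve-∀
    diagonal-entry : ∀ i j → diagonal i j ≡ (if ⌊ i ≟ j ⌋ then d i * d i * d i else + 0)
    diagonal-entry i j with i ≟ j
    ... | yes refl = refl
    ... | no _     = vanishes (d i) (d j)
    adjacency-entry : ∀ i j → adjacency i j ≡ (if adj G i j then d i * d j else + 0)
    adjacency-entry i j with adj G i j
    ... | true  = cong (λ a → a * d j) (ℤP.*-identityʳ (d i))
    ... | false = vanishes (d i) (d j)
    diagonal-part : sum (λ i → sum (diagonal i)) ≡ F G
    diagonal-part = begin
      sum (λ i → sum (diagonal i))
        ≡⟨ sum-cong-≗ (λ i → trans (sum-cong-≗ (diagonal-entry i)) (sum-diagonal i (d i * d i * d i))) ⟩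
      sum (λ i → d i * d i * d i)
        ≡⟨ sym (sumℤ≡sum (λ i → d i * d i * d i)) ⟩
      F G
        ∎
    adjacency-part : sum (λ i → sum (adjacency i)) ≡ M₂ G + M₂ G
    adjacency-part = begin
      sum (λ i → sum (adjacency i))
        ≡⟨ sum-cong-≗ (λ i → sum-cong-≗ (adjacency-entry i)) ⟩
      sum (λ i → sum (λ j → if adj G i j then d i * d j else + 0))
        ≡⟨ sum-adjacent (λ i j → d i * d j) ⟩
      M₂ G + edgeSum G (λ i j → d j * d i)
        ≡⟨ cong (λ s → M₂ G + s) (edgeSum-cong (λ i j → ℤP.*-comm (d j) (d i))) ⟩
      M₂ G + M₂ G
        ∎

  ∈-edgeList⇒adj : ∀ {i j} → (i , j) ∈ edgeList → adj G i j ≡ true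
  ∈-edgeList⇒adj ij∈ =
    to T-≡ (proj₂ (to T-∧ (proj₂ (∈-filter⁻ (T? ∘ isOrientedEdge) {xs = allPairs n} ij∈))))

  adj⇒∈-edgeList : ∀ {i j} → i Fin.< j → adj G i j ≡ true → (i , j) ∈ edgeList
  adj⇒∈-edgeList {i} {j} i<j ij = ∈-filter⁺ (T? ∘ isOrientedEdge)
    (∈-cartesianProduct⁺ (∈-allFin i) (∈-allFin j)) (from T-∧ (fromWitness i<j , from T-≡ ij))

  edge-representative : ∀ {i j} → adj G i j ≡ true →
    Σ (Fin n × Fin n) λ p → p ∈ edgeList × uncurry degreeGap p ≡ degreeGap i j
  edge-representative {i} {j} ij with <-cmp i j
  ... | tri< i<j _ _  = (i , j) , adj⇒∈-edgeList i<j ij , refl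
  ... | tri≈ _ refl _ = contradiction (trans (sym (loopless G i)) ij) λ ()
  ... | tri> _ _ j<i  = (j , i) , adj⇒∈-edgeList j<i (trans (adj-sym G j i) ij)
                      , cong +_ (ℕP.∣-∣-comm (deg G j) (deg G i))

  UniformGap : ℕ → Set
  UniformGap ε = ∀ i j → adj G i j ≡ true → ∣ deg G i - deg G j ∣ ≡ ε

  open CauchySchwarz (uncurry degreeGap) using (ConstantOn)

  constantOn⇒uniformGap : ∀ {a b} → adj G a b ≡ true → ConstantOn edgeList →
                          UniformGap ∣ deg G a - deg G b ∣
  constantOn⇒uniformGap ab constant i j ij with edge-representative ij | edge-representative ab
  ... | p , p∈ , p≡ | q , q∈ , q≡ = ℤP.+-injective (trans (sym p≡) (trans (constant p∈ q∈) q≡))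

  uniformGap⇒constantOn : ∀ {ε} → UniformGap ε → ConstantOn edgeList
  uniformGap⇒constantOn gap {i , j} {k , l} ij∈ kl∈ =
    cong +_ (trans (gap i j (∈-edgeList⇒adj ij∈)) (sym (gap k l (∈-edgeList⇒adj kl∈))))

  uniformGap-0⇒regular : Connected G → UniformGap 0 → Regular G
  uniformGap-0⇒regular connected gap i j = along (connected i j)
    where
    along : ∀ {i j} → Reach G i j → deg G i ≡ deg G j
    along here                 = refl
    along (step {i} {k} ik walk) = trans (ℕP.∣m-n∣≡0⇒m≡n (gap i k ik)) (along walk)

  uniformGap⇒regular⊎weaklySemiregular : ∀ {a b ε} → Connected G → adj G a b ≡ true → UniformGap ε →
                                          Regular G ⊎ WeaklySemiregular G
  uniformGap⇒regular⊎weaklySemiregular {ε = 0} connected ab gap =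
    inj₁ (uniformGap-0⇒regular connected gap)
  uniformGap⇒regular⊎weaklySemiregular {a} {b} {ε = suc ε} connected ab gap =
    inj₂ (connected , non-regular , suc ε , s≤s z≤n , gap)
    where
    non-regular : ¬ Regular G
    non-regular regular with trans (sym (ℕP.m≡n⇒∣m-n∣≡0 (regular a b))) (gap a b ab)
    ... | ()

  regular⊎weaklySemiregular⇒uniformGap : Regular G ⊎ WeaklySemiregular G → Σ ℕ UniformGap
  regular⊎weaklySemiregular⇒uniformGap (inj₁ regular) = 0 , λ i j _ → ℕP.m≡n⇒∣m-n∣≡0 (regular i j)
  regular⊎weaklySemiregular⇒uniformGap (inj₂ (_ , _ , ε , _ , gap)) = ε , gap

  constantOn⇔regular⊎weaklySemiregular : ∀ {a b} → Connected G → adj G a b ≡ true →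
    ConstantOn edgeList ⇔ (Regular G ⊎ WeaklySemiregular G)
  constantOn⇔regular⊎weaklySemiregular connected ab = mk⇔
    (uniformGap⇒regular⊎weaklySemiregular connected ab ∘ constantOn⇒uniformGap ab)
    (λ rw → uniformGap⇒constantOn (proj₂ (regular⊎weaklySemiregular⇒uniformGap rw)))

  private
    [edgeSum-degreeGap]²≡[sumBy-degreeGap]² : edgeSum G degreeGap * edgeSum G degreeGap
      ≡ sumBy (uncurry degreeGap) edgeList * sumBy (uncurry degreeGap) edgeList
    [edgeSum-degreeGap]²≡[sumBy-degreeGap]² = cong₂ _*_ (edgeSum≡sumBy degreeGap) (edgeSum≡sumBy degreeGap)

    edges*[F-2M₂]≡length*sumBy-degreeGap² : edges G * (F G - + 2 * M₂ G)
      ≡ + length edgeList * sumBy (λ (i , j) → degreeGap i j * degreeGap i j) edgeList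
    edges*[F-2M₂]≡length*sumBy-degreeGap² =
      cong₂ _*_ edges≡length (trans F-2M₂≡edgeSum-degreeGap² (edgeSum≡sumBy _))

  degreeGap-cauchySchwarz : edgeSum G degreeGap * edgeSum G degreeGap ≤ℤ edges G * (F G - + 2 * M₂ G)
  degreeGap-cauchySchwarz =
    subst₂ _≤ℤ_ (sym [edgeSum-degreeGap]²≡[sumBy-degreeGap]²) (sym edges*[F-2M₂]≡length*sumBy-degreeGap²)
      (CauchySchwarz.cauchySchwarz (uncurry degreeGap) edgeList)

  degreeGap-cauchySchwarz-≡⇔constantOn :
    (edgeSum G degreeGap * edgeSum G degreeGap ≡ edges G * (F G - + 2 * M₂ G)) ⇔ ConstantOn edgeList
  degreeGap-cauchySchwarz-≡⇔constantOn =
    subst₂ (λ l r → (l ≡ r) ⇔ ConstantOn edgeList)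
      (sym [edgeSum-degreeGap]²≡[sumBy-degreeGap]²) (sym edges*[F-2M₂]≡length*sumBy-degreeGap²)
      (CauchySchwarz.cauchySchwarz-≡⇔constantOn (uncurry degreeGap) edgeList)

some-edge : ∀ {n} (G : Graph n) → 2 ≤ n → Connected G → ∃₂ λ a b → adj G a b ≡ true
some-edge G (s≤s (s≤s z≤n)) connected with connected zero (suc zero)
... | step ab _ = zero , _ , ab

proposition12 : ∀ {n : ℕ} (G : Graph n) → 3 ≤ n → Connected G →
    ((edgeSum G (λ i j → + ∣ deg G i - deg G j ∣) * edgeSum G (λ i j → + ∣ deg G i - deg G j ∣))
       ≤ℤ (edges G * (F G - + 2 * M₂ G)))
    × ((edges G * (F G - + 2 * M₂ G)) ≡ (edges G * dᵀLd G))
    × (((edgeSum G (λ i j → + ∣ deg G i - deg G j ∣) * edgeSum G (λ i j → + ∣ deg G i - deg G j ∣))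
         ≡ (edges G * (F G - + 2 * M₂ G)))
       ⇔ (Regular G ⊎ WeaklySemiregular G))
proposition12 G 3≤n connected with some-edge G (ℕP.<⇒≤ 3≤n) connected
... | _ , _ , ab =
    degreeGap-cauchySchwarz G
  , cong (λ s → edges G * s) (sym (dᵀLd≡F-2M₂ G))
  , ⇔.trans (degreeGap-cauchySchwarz-≡⇔constantOn G) (constantOn⇔regular⊎weaklySemiregular G connected ab)
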